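{- Let $P_k(m) = 2(m-1)^{k+1} + (k+1)(m-1)^{k} - 2(k+1)m^{k} + (k-1)$. For odd integers $k \geq 3$, the value $P_k\big((k+1)(k-2)\big)$ is negative when $k = 3$ and positive for every odd $k \geq 5$.
   Context: $P_k(m)$ equals $2(k+1)\left(S_{\mathbb{R}}(m-1,k) - m^k\right)$ with $S_{\mathbb{R}}(m-1,k) = \frac{(m-1)^{k+1}-1}{k+1} + \frac{1+(m-1)^k}{2}$. -}

module Defs where

open import Data.Nat using (ℕ)
open import Data.Integer using (ℤ; +_; _+_; _-_; _*_; _^_)

P : ℕ → ℤ → ℤ
P k m = (+ 2) * (m - + 1) ^ (Data.Nat.suc k)
      + (+ k + + 1) * (m - + 1) ^ k
      - (+ 2) * (+ k + + 1) * m ^ k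
      + (+ k - + 1)

{-# OPTIONS --safe #-}
module Submission where

open import Defs
open import Data.Nat using (ℕ; _≥_; _+_; _*_; _∸_; _%_)
open import Data.Integer using (+_; _<_; 0ℤ)
open import Data.Product using (_×_)
open import Relation.Binary.PropositionalEquality using (_≡_)

open import Data.Nat using (suc; _^_; _≤_; s≤s; z≤n; z<s; NonZero; >-nonZero)
open import Data.Nat.Properties
  using (*-identityʳ; *-assoc; *-comm; *-suc; *-monoˡ-≤; *-monoʳ-≤; *-cancelʳ-≤;
         +-comm; +-monoˡ-≤; +-monoʳ-≤; +-suc; m≤m+n; m≤n*m; ≤-trans; ≤-reflexive;
         n≤1+n; *-commutativeSemigroup; module ≤-Reasoning)
open import Algebra.Properties.CommutativeSemigroup *-commutativeSemigroup
  using (xy∙z≈y∙xz; x∙yz≈y∙xz)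
open import Data.Nat.Tactic.RingSolver using (solve)
open import Data.List using (_∷_; [])
import Data.Integer as ℤ
open import Data.Integer.Properties using (pos-*; i≤j⇒0≤j-i; +-mono-≤-<)
open import Data.Product using (_,_)
open import Relation.Binary.PropositionalEquality using (refl; sym; trans; cong; subst)

-- With a = m − 1 and b = a − k, induction on k gives (1 + a)ᵏ b ≤ aᵏ⁺¹, that is
-- (1 + 1/a)ᵏ ≤ a/(a − k). For m = (k + 1)(k − 2) and k ≥ 4 we have b ≥ k + 1, hence
-- 2(k + 1)mᵏ ≤ 2aᵏ⁺¹ and P_k(m) ≥ (k + 1)aᵏ + k − 1 > 0.
-- For k = 3 one computes P₃(4) = −240.

[1+a]^n*b≤a^[1+n] : ∀ n b {a} → b + n ≡ a → suc a ^ n * b ≤ a ^ suc n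
[1+a]^n*b≤a^[1+n] 0       b {a} b+0≡a = ≤-reflexive (trans b+0≡a (sym (*-identityʳ a)))
[1+a]^n*b≤a^[1+n] (suc n) b {a} b+[1+n]≡a = begin
  suc a * suc a ^ n * b     ≡⟨ xy∙z≈y∙xz (suc a) (suc a ^ n) b ⟩
  suc a ^ n * (suc a * b)   ≤⟨ *-monoʳ-≤ (suc a ^ n) [1+a]b≤a[1+b] ⟩
  suc a ^ n * (a * suc b)   ≡⟨ x∙yz≈y∙xz (suc a ^ n) a (suc b) ⟩
  a * (suc a ^ n * suc b)   ≤⟨ *-monoʳ-≤ a ([1+a]^n*b≤a^[1+n] n (suc b) [1+b]+n≡a) ⟩
  a * a ^ suc n             ∎
  where
  open ≤-Reasoning
  [1+b]+n≡a : suc b + n ≡ a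
  [1+b]+n≡a = trans (sym (+-suc b n)) b+[1+n]≡a
  [1+a]b≤a[1+b] : suc a * b ≤ a * suc b
  [1+a]b≤a[1+b] = begin
    b + a * b ≤⟨ +-monoˡ-≤ (a * b) (subst (b ≤_) b+[1+n]≡a (m≤m+n b (suc n))) ⟩
    a + a * b ≡⟨ sym (*-suc a b) ⟩
    a * suc b ∎

[1+n]*[1+a]^n≤a^[1+n] : ∀ n b {a} → b + n ≡ a → suc n ≤ b → suc n * suc a ^ n ≤ a ^ suc n
[1+n]*[1+a]^n≤a^[1+n] n b {a} b+n≡a 1+n≤b = *-cancelʳ-≤ _ _ b (begin
  suc n * suc a ^ n * b     ≡⟨ *-assoc (suc n) (suc a ^ n) b ⟩
  suc n * (suc a ^ n * b)   ≤⟨ *-monoʳ-≤ (suc n) ([1+a]^n*b≤a^[1+n] n b b+n≡a) ⟩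
  suc n * a ^ suc n         ≤⟨ *-monoˡ-≤ (a ^ suc n) 1+n≤b ⟩
  b * a ^ suc n             ≡⟨ *-comm b (a ^ suc n) ⟩
  a ^ suc n * b             ∎)
  where
  open ≤-Reasoning
  instance
    b≢0 : NonZero b
    b≢0 = >-nonZero (≤-trans (s≤s z≤n) 1+n≤b)

pos-^ : ∀ m n → (+ m) ℤ.^ n ≡ + (m ^ n)
pos-^ m 0       = refl
pos-^ m (suc n) = trans (cong ((+ m) ℤ.*_) (pos-^ m n)) (sym (pos-* m (m ^ n)))

P[1+a]-expansion : ∀ k a →
  P k (+ suc a) ≡ (+ (2 * a ^ suc k + (k + 1) * a ^ k) ℤ.- + (2 * (k + 1) * suc a ^ k))
                    ℤ.+ (+ k ℤ.- + 1)
P[1+a]-expansion k a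
  rewrite pos-^ a (suc k) | pos-^ a k | pos-^ (suc a) k
        | sym (pos-* 2 (a ^ suc k)) | sym (pos-* (k + 1) (a ^ k))
        | sym (pos-* 2 (k + 1)) | sym (pos-* (2 * (k + 1)) (suc a ^ k)) = refl

0<P[1+a] : ∀ k a → 2 ≤ k → suc k * suc a ^ k ≤ a ^ suc k → 0ℤ < P k (+ suc a)
0<P[1+a] k a (s≤s (s≤s _)) [1+k][1+a]^k≤a^[1+k] =
  subst (0ℤ <_) (sym (P[1+a]-expansion k a)) (+-mono-≤-< (i≤j⇒0≤j-i (ℤ.+≤+ subtrahend≤minuend)) (ℤ.+<+ z<s))
  where
  open ≤-Reasoning
  subtrahend≤minuend : 2 * (k + 1) * suc a ^ k ≤ 2 * a ^ suc k + (k + 1) * a ^ k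
  subtrahend≤minuend = begin
    2 * (k + 1) * suc a ^ k   ≡⟨ cong (λ c → 2 * c * suc a ^ k) (+-comm k 1) ⟩
    2 * suc k * suc a ^ k     ≡⟨ *-assoc 2 (suc k) (suc a ^ k) ⟩
    2 * (suc k * suc a ^ k)   ≤⟨ *-monoʳ-≤ 2 [1+k][1+a]^k≤a^[1+k] ⟩
    2 * a ^ suc k             ≤⟨ m≤m+n (2 * a ^ suc k) ((k + 1) * a ^ k) ⟩
    2 * a ^ suc k + (k + 1) * a ^ k ∎

0<P[[k+1][k-2]] : ∀ k → 4 ≤ k → 0ℤ < P k (+ ((k + 1) * (k ∸ 2)))
0<P[[k+1][k-2]] k@(suc (suc (suc (suc i)))) (s≤s (s≤s (s≤s (s≤s z≤n)))) =
  subst (λ m → 0ℤ < P k (+ m)) (sym m≡1+a)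
    (0<P[1+a] k a (s≤s (s≤s z≤n)) ([1+n]*[1+a]^n≤a^[1+n] k b b+k≡a 1+k≤b))
  where
  a b : ℕ
  a = 9 + 7 * i + i * i
  b = 5 + 6 * i + i * i
  m≡1+a : (4 + i + 1) * (2 + i) ≡ 10 + 7 * i + i * i
  m≡1+a = solve (i ∷ [])
  b+k≡a : 5 + 6 * i + i * i + (4 + i) ≡ 9 + 7 * i + i * i
  b+k≡a = solve (i ∷ [])
  1+k≤b : 5 + i ≤ 5 + 6 * i + i * i
  1+k≤b = ≤-trans (+-monoʳ-≤ 5 (m≤n*m i 6)) (m≤m+n (5 + 6 * i) (i * i))

lemma13 : (P 3 (+ ((3 + 1) * (3 ∸ 2))) < 0ℤ)
    × ((k : ℕ) → k % 2 ≡ 1 → k ≥ 5 → 0ℤ < P k (+ ((k + 1) * (k ∸ 2))))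
lemma13 = ℤ.-<+ , λ k _ k≥5 → 0<P[[k+1][k-2]] k (≤-trans (n≤1+n 4) k≥5)
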